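{- Let $f$ be a choice function for $L$ of the form $f=\min_<$ for some regular total ordering $<$ of $Sen(L)$. Then $f$ is $\neg$-decreasing if and only if for every truth assignment $M$ and all $\varphi,\psi\in Sen(L_s)$, $$\langle M,f\rangle\models_s\varphi\wedge\neg\psi\rightarrow(\varphi|\psi\leftrightarrow\neg\varphi|\neg\psi).$$
   Context: $L$ is the propositional language with atoms $p_0,p_1,\ldots$ and connectives $\neg,\wedge$ (others defined); $L_s$ adds a primitive binary connective $|$. $\sim$ is classical equivalence on $Sen(L)$, $[\alpha]=\{\beta:\beta\sim\alpha\}$. A total ordering $<$ of $Sen(L)$ is regular if $\alpha\not\sim\beta$ and $\alpha<\beta$ imply $\alpha'<\beta'$ for all $\alpha'\in[\alpha],\beta'\in[\beta]$; it is $\neg$-decreasing if for all $\alpha\not\sim\beta$: $\alpha<\beta\iff\neg\beta<\neg\alpha$. A choice function for $L$ is a map $f$ with $f(\alpha,\beta)=f(\{\alpha,\beta\})\in\{\alpha,\beta\}$; such $f=\min_<$ (with $<$ regular total) is $\neg$-decreasing if $<$ is $\neg$-decreasing. $f$ induces $\overline f:Sen(L_s)\to Sen(L)$: identity on $Sen(L)$, commuting with $\neg,\wedge$, and $\overline f(\varphi|\psi)=f(\overline f(\varphi),\overline f(\psi))$. For a truth assignment $M$ of $Sen(L)$, $\langle M,f\rangle\models_s\varphi$ iff $M\models\overline f(\varphi)$. -}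

module Defs where

open import Data.Nat using (ℕ)
open import Data.Bool using (Bool; true; false; not; _∧_)
open import Data.Product using (_×_)
open import Relation.Binary.PropositionalEquality using (_≡_)
open import Relation.Binary.Core using (Rel)
open import Relation.Binary.Structures using (IsStrictTotalOrder)
open import Relation.Binary.Definitions using (tri<; tri≈; tri>)
open import Relation.Nullary using (¬_)
open import Level using (0ℓ)

data Sen : Set where
  atom : ℕ → Sen
  neg  : Sen → Sen
  conj : Sen → Sen → Sen

data SenS : Set where
  atom : ℕ → SenS
  neg  : SenS → SenS
  conj : SenS → SenS → SenS
  sel  : SenS → SenS → SenS

impS : SenS → SenS → SenS
impS φ ψ = neg (conj φ (neg ψ))

iffS : SenS → SenS → SenS
iffS φ ψ = conj (impS φ ψ) (impS ψ φ)

Assignment : Set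
Assignment = ℕ → Bool

eval : Assignment → Sen → Bool
eval M (atom n)   = M n
eval M (neg α)    = not (eval M α)
eval M (conj α β) = eval M α ∧ eval M β

_∼_ : Sen → Sen → Set
α ∼ β = ∀ (M : Assignment) → eval M α ≡ eval M β

-- total orderings of Sen(L): strict total orders w.r.t. syntactic identity
TotalOrdering : Rel Sen 0ℓ → Set
TotalOrdering _<_ = IsStrictTotalOrder _≡_ _<_

Regular : Rel Sen 0ℓ → Set
Regular _<_ = ∀ α β → ¬ (α ∼ β) → α < β →
  ∀ α′ β′ → α′ ∼ α → β′ ∼ β → α′ < β′

NegDecreasing : Rel Sen 0ℓ → Set
NegDecreasing _<_ = ∀ α β → ¬ (α ∼ β) →
  ((α < β → neg β < neg α) × (neg β < neg α → α < β))

minF : {_<_ : Rel Sen 0ℓ} → TotalOrdering _<_ → Sen → Sen → Sen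
minF ord α β with IsStrictTotalOrder.compare ord α β
... | tri< _ _ _ = α
... | tri≈ _ _ _ = α
... | tri> _ _ _ = β

fbar : (Sen → Sen → Sen) → SenS → Sen
fbar f (atom n)   = atom n
fbar f (neg φ)    = neg (fbar f φ)
fbar f (conj φ ψ) = conj (fbar f φ) (fbar f ψ)
fbar f (sel φ ψ)  = f (fbar f φ) (fbar f ψ)

_,_⊨s_ : Assignment → (Sen → Sen → Sen) → SenS → Set
M , f ⊨s φ = eval M (fbar f φ) ≡ true

{-# OPTIONS --safe #-}
-- Suppose M ⊨ α and M ⊭ β.  Then min(α, β) is true under M iff α < β, and
-- min(¬α, ¬β) = min(¬β, ¬α) is true under M iff ¬β < ¬α; so the instance of the
-- schema at M says exactly that α < β ⟺ ¬β < ¬α.  Every L_s-instance of the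
-- schema is such an L-instance at α = f̄ φ, β = f̄ ψ, and conversely L embeds in
-- L_s.  For the converse direction, if α < β and ¬α < ¬β then no assignment can
-- separate α from β in either order, hence α ∼ β.
module Submission where

open import Defs
open import Data.Bool using (true; false; not)
open import Data.Bool.Properties using (⇔→≡)
open import Data.Product using (_×_; _,_; uncurry)
open import Function.Bundles using (_⇔_; mk⇔; Equivalence)
open import Function.Properties.Equivalence using ()
  renaming (trans to ⇔-trans; sym to ⇔-sym)
open import Level using (0ℓ)
open import Relation.Binary.Core using (Rel)
open import Relation.Binary.Definitions using (Tri; tri<; tri≈; tri>)
open import Relation.Binary.PropositionalEquality
  using (_≡_; refl; sym; trans; cong; cong₂; subst; subst₂)
open import Relation.Binary.Structures using (IsStrictTotalOrder)
open import Relation.Nullary using (¬_; contradiction)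

open Equivalence using (to; from)

neg-injective : ∀ {α β : Sen} → neg α ≡ neg β → α ≡ β
neg-injective refl = refl

∼-sym : ∀ {α β} → α ∼ β → β ∼ α
∼-sym α∼β M = sym (α∼β M)

separated⇒≁ : ∀ {M} α β → eval M α ≡ true → eval M β ≡ false → ¬ (α ∼ β)
separated⇒≁ {M} α β Mα Mβ α∼β with trans (sym Mα) (trans (α∼β M) Mβ)
... | ()

reflections⇒≡⇔⇔ : ∀ {x y} {P Q : Set} →
  x ≡ true ⇔ P → y ≡ true ⇔ Q → x ≡ y ⇔ (P ⇔ Q)
reflections⇒≡⇔⇔ x⇔P y⇔Q = mk⇔
  (λ { refl → ⇔-trans (⇔-sym x⇔P) y⇔Q })
  (λ P⇔Q → ⇔→≡ (⇔-trans x⇔P (⇔-trans P⇔Q (⇔-sym y⇔Q))))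

Schema : SenS → SenS → SenS
Schema φ ψ = impS (conj φ (neg ψ)) (iffS (sel φ ψ) (sel (neg φ) (neg ψ)))

-- fbar f (Schema φ ψ) reduces to schemaᴸ f (fbar f φ) (fbar f ψ).
schemaᴸ : (Sen → Sen → Sen) → Sen → Sen → Sen
schemaᴸ f α β = impᴸ (conj α (neg β)) (iffᴸ (f α β) (f (neg α) (neg β)))
  where
  impᴸ iffᴸ : Sen → Sen → Sen
  impᴸ γ δ = neg (conj γ (neg δ))
  iffᴸ γ δ = conj (impᴸ γ δ) (impᴸ δ γ)

SchemaᴸValid : (Sen → Sen → Sen) → Set
SchemaᴸValid f = ∀ M α β → eval M (schemaᴸ f α β) ≡ true

eval-schemaᴸ-separated : ∀ {M α β} (f : Sen → Sen → Sen) →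
  eval M α ≡ true → eval M β ≡ false →
  eval M (schemaᴸ f α β) ≡ true ⇔ eval M (f α β) ≡ eval M (f (neg α) (neg β))
eval-schemaᴸ-separated {M} {α} {β} f Mα Mβ
  rewrite Mα | Mβ
  with eval M (f α β) | eval M (f (neg α) (neg β))
... | true  | true  = mk⇔ (λ _ → refl) (λ _ → refl)
... | true  | false = mk⇔ (λ ()) (λ ())
... | false | true  = mk⇔ (λ ()) (λ ())
... | false | false = mk⇔ (λ _ → refl) (λ _ → refl)

embed : Sen → SenS
embed (atom n)   = atom n
embed (neg α)    = neg (embed α)
embed (conj α β) = conj (embed α) (embed β)

fbar-embed : ∀ f α → fbar f (embed α) ≡ α
fbar-embed f (atom n)   = refl
fbar-embed f (neg α)    = cong neg (fbar-embed f α)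
fbar-embed f (conj α β) = cong₂ conj (fbar-embed f α) (fbar-embed f β)

⊨s-Schema⇒SchemaᴸValid : ∀ f → (∀ M φ ψ → M , f ⊨s Schema φ ψ) → SchemaᴸValid f
⊨s-Schema⇒SchemaᴸValid f H M α β =
  subst₂ (λ γ δ → eval M (schemaᴸ f γ δ) ≡ true)
         (fbar-embed f α) (fbar-embed f β) (H M (embed α) (embed β))

module _ {_<_ : Rel Sen 0ℓ} (ord : TotalOrdering _<_) where
  open IsStrictTotalOrder ord using (compare; irrefl; asym)

  minF-≡ˡ : ∀ {α β} → α < β → minF ord α β ≡ α
  minF-≡ˡ {α} {β} α<β with compare α β
  ... | tri< _ _ _   = refl
  ... | tri≈ _ _ _   = refl
  ... | tri> α≮β _ _ = contradiction α<β α≮β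

  minF-≡ʳ : ∀ {α β} → β < α → minF ord α β ≡ β
  minF-≡ʳ {α} {β} β<α with compare α β
  ... | tri< _ _ β≮α = contradiction β<α β≮α
  ... | tri≈ _ _ β≮α = contradiction β<α β≮α
  ... | tri> _ _ _   = refl

  minF-comm : ∀ α β → minF ord α β ≡ minF ord β α
  minF-comm α β = by-trichotomy (compare α β)
    where
    by-trichotomy : Tri (α < β) (α ≡ β) (β < α) → minF ord α β ≡ minF ord β α
    by-trichotomy (tri< α<β _ _) = trans (minF-≡ˡ α<β) (sym (minF-≡ʳ α<β))
    by-trichotomy (tri≈ _ refl _) = refl
    by-trichotomy (tri> _ _ β<α) = trans (minF-≡ʳ β<α) (sym (minF-≡ˡ β<α))

  eval-minF-separated : ∀ {M α β} → eval M α ≡ true → eval M β ≡ false →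
    eval M (minF ord α β) ≡ true ⇔ α < β
  eval-minF-separated {M} {α} {β} Mα Mβ = mk⇔ true⇒< <⇒true
    where
    true⇒< : eval M (minF ord α β) ≡ true → α < β
    true⇒< Mmin with compare α β
    ... | tri< α<β _ _ = α<β
    ... | tri≈ _ refl _ = contradiction (trans (sym Mα) Mβ) λ ()
    ... | tri> _ _ _    = contradiction (trans (sym Mmin) Mβ) λ ()
    <⇒true : α < β → eval M (minF ord α β) ≡ true
    <⇒true α<β rewrite minF-≡ˡ α<β = Mα

  schemaᴸ-minF⇔neg-reversed : ∀ {M α β} → eval M α ≡ true → eval M β ≡ false →
    eval M (schemaᴸ (minF ord) α β) ≡ true ⇔ (α < β ⇔ neg β < neg α)
  schemaᴸ-minF⇔neg-reversed {M} {α} {β} Mα Mβ =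
    ⇔-trans (eval-schemaᴸ-separated (minF ord) Mα Mβ)
      (reflections⇒≡⇔⇔ (eval-minF-separated Mα Mβ) min-neg-true⇔neg-reversed)
    where
    min-neg-true⇔neg-reversed : eval M (minF ord (neg α) (neg β)) ≡ true ⇔ neg β < neg α
    min-neg-true⇔neg-reversed =
      subst (λ γ → eval M γ ≡ true ⇔ neg β < neg α) (minF-comm (neg β) (neg α))
            (eval-minF-separated (cong not Mβ) (cong not Mα))

  negDecreasing⇒SchemaᴸValid : NegDecreasing _<_ → SchemaᴸValid (minF ord)
  negDecreasing⇒SchemaᴸValid nd M α β = by-values (eval M α) (eval M β) refl refl
    where
    by-values : ∀ a b → eval M α ≡ a → eval M β ≡ b →
      eval M (schemaᴸ (minF ord) α β) ≡ true
    by-values true  false Mα Mβ = from (schemaᴸ-minF⇔neg-reversed Mα Mβ)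
                                       (uncurry mk⇔ (nd α β (separated⇒≁ α β Mα Mβ)))
    by-values true  true  Mα Mβ rewrite Mα | Mβ = refl
    by-values false _     Mα _  rewrite Mα = refl

  SchemaᴸValid⇒neg-monotone⇒∼ : SchemaᴸValid (minF ord) →
    ∀ {α β} → α < β → neg α < neg β → α ∼ β
  SchemaᴸValid⇒neg-monotone⇒∼ H {α} {β} α<β ¬α<¬β M
    with eval M α in Mα | eval M β in Mβ
  ... | true  | false = contradiction
        (to (to (schemaᴸ-minF⇔neg-reversed Mα Mβ) (H M α β)) α<β) (asym ¬α<¬β)
  ... | false | true  = contradiction
        (from (to (schemaᴸ-minF⇔neg-reversed Mβ Mα) (H M β α)) ¬α<¬β) (asym α<β)
  ... | true  | true  = refl
  ... | false | false = refl

  SchemaᴸValid⇒negDecreasing : SchemaᴸValid (minF ord) → NegDecreasing _<_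
  SchemaᴸValid⇒negDecreasing H α β α≁β = neg-reverses , neg-reflects
    where
    neg-reverses : α < β → neg β < neg α
    neg-reverses α<β with compare (neg β) (neg α)
    ... | tri< ¬β<¬α _ _ = ¬β<¬α
    ... | tri≈ _ ¬β≡¬α _ = contradiction α<β (irrefl (sym (neg-injective ¬β≡¬α)))
    ... | tri> _ _ ¬α<¬β = contradiction (SchemaᴸValid⇒neg-monotone⇒∼ H α<β ¬α<¬β) α≁β

    neg-reflects : neg β < neg α → α < β
    neg-reflects ¬β<¬α with compare α β
    ... | tri< α<β _ _ = α<β
    ... | tri≈ _ α≡β _ = contradiction ¬β<¬α (irrefl (cong neg (sym α≡β)))
    ... | tri> _ _ β<α =
      contradiction (∼-sym {β} {α} (SchemaᴸValid⇒neg-monotone⇒∼ H β<α ¬β<¬α)) α≁β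

theorem2p42 : (_<_ : Rel Sen 0ℓ) (ord : TotalOrdering _<_) → Regular _<_ →
    (NegDecreasing _<_ →
      ∀ (M : Assignment) (φ ψ : SenS) →
        M , minF ord ⊨s impS (conj φ (neg ψ)) (iffS (sel φ ψ) (sel (neg φ) (neg ψ))))
    × ((∀ (M : Assignment) (φ ψ : SenS) →
        M , minF ord ⊨s impS (conj φ (neg ψ)) (iffS (sel φ ψ) (sel (neg φ) (neg ψ))))
      → NegDecreasing _<_)
theorem2p42 _<_ ord _ =
  (λ nd M φ ψ →
    negDecreasing⇒SchemaᴸValid ord nd M (fbar (minF ord) φ) (fbar (minF ord) ψ)) ,
  (λ H → SchemaᴸValid⇒negDecreasing ord (⊨s-Schema⇒SchemaᴸValid (minF ord) H))
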